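{- Let $n,q\in\mathbb{N}$ with $q\leqslant n$. Let $\Gamma=K_{n,n}-nK_2$ and assume $G^+=\mathrm{Diag}(H\times H)$ where $H\leqslant\mathrm{Sym}(n)$. Suppose $\mathcal P=\{P_1,\dots,P_m\}$ is a partition of the vertex set of $\Gamma$ such that for each $i$, $P_i\cap\Delta$ is a subset of $\mathcal V_n(a,q)$ for some $a$, and $P_i\cap\Delta'$ is a subset of $\mathcal U_n(b,q)$ for some $b$. Then the subgroup of $G^+$ stabilising every part of $\mathcal P$ is trivial.
   Context: $\Gamma$ has parts $\Delta=\{v_1,\dots,v_n\}$ and $\Delta'=\{u_1,\dots,u_n\}$, with non-edges exactly the pairs $\{v_i,u_i\}$. $(g,g')\in\mathrm{Sym}(n)\times\mathrm{Sym}(n)$ acts by $v_i\mapsto v_{i^g}$, $u_i\mapsto u_{i^{g'}}$; $G^+$ is the index-two subgroup of $G\leqslant\mathrm{Aut}(\Gamma)$ preserving each part, and $\mathrm{Diag}(H\times H)=\{(h,h):h\in H\}$. For $n,i,q\in\mathbb N$: $\mathcal V_n(i,q)=\{v_j:(i-1)q<j\leqslant\min(iq,n)\}$ and $\mathcal U_n(i,q)=\{u_j: j\equiv i \pmod q,\ j\leqslant n\}$. -}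

module Defs where

open import Data.Nat using (ℕ; suc; _*_; _∸_; _<_; _≤_; _⊓_)
open import Data.Fin using (Fin; toℕ)
open import Data.Fin.Permutation using (Permutation′; _⟨$⟩ʳ_; id; _∘ₚ_; flip)
open import Data.Integer using (ℤ; +_; _-_)
open import Data.Integer.Divisibility using (_∣_)
open import Data.Sum using (_⊎_; inj₁; inj₂)
open import Data.Product using (_×_; Σ; ∃)
open import Relation.Binary.PropositionalEquality using (_≡_)

-- Vertices of Γ = K_{n,n} - nK_2:
--   inj₁ j  is  v_{toℕ j + 1}  (the part Δ)
--   inj₂ j  is  u_{toℕ j + 1}  (the part Δ')
Vertex : ℕ → Set
Vertex n = Fin n ⊎ Fin n

idx : ∀ {n} → Fin n → ℕ
idx j = suc (toℕ j)

-- congruence of natural numbers modulo q (q = 0 allowed: means equality)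
_≡_[mod_] : ℕ → ℕ → ℕ → Set
j ≡ i [mod q ] = (+ q) ∣ ((+ j) - (+ i))

InV : (n a q j : ℕ) → Set
InV n a q j = ((a ∸ 1) * q < j) × (j ≤ (a * q) ⊓ n)

InU : (n b q j : ℕ) → Set
InU n b q j = (j ≡ b [mod q ]) × (j ≤ n)

record IsSubgroup (n : ℕ) (H : Permutation′ n → Set) : Set₁ where
  field
    has-id  : H id
    closed-∘ : ∀ {g h} → H g → H h → H (g ∘ₚ h)
    closed-⁻¹ : ∀ {g} → H g → H (flip g)

-- the action of (g, g) ∈ Diag(H × H) on vertices:  v_i ↦ v_{i^g},  u_i ↦ u_{i^g}
diagAct : ∀ {n} → Permutation′ n → Vertex n → Vertex n
diagAct g (inj₁ j) = inj₁ (g ⟨$⟩ʳ j)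
diagAct g (inj₂ j) = inj₂ (g ⟨$⟩ʳ j)

-- a partition {P_1,…,P_m} of the vertex set, given by the part-assignment
-- P : Vertex n → Fin m, all parts non-empty (P surjective)
IsPartition : ∀ {n m} → (Vertex n → Fin m) → Set
IsPartition {n} {m} P = ∀ (i : Fin m) → ∃ λ (x : Vertex n) → P x ≡ i

PartsAdapted : ∀ {n m} → (q : ℕ) → (Vertex n → Fin m) → Set
PartsAdapted {n} {m} q P =
  ∀ (i : Fin m) →
    (∃ λ (a : ℕ) → ∀ (j : Fin n) → P (inj₁ j) ≡ i → InV n a q (idx j))
  × (∃ λ (b : ℕ) → ∀ (j : Fin n) → P (inj₂ j) ≡ i → InU n b q (idx j))

StabilisesParts : ∀ {n m} → (Vertex n → Fin m) → (Vertex n → Vertex n) → Set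
StabilisesParts {n} P σ = ∀ (x : Vertex n) → P (σ x) ≡ P x

-- If h stabilises every part, then v_j and v_{j^h} lie in one part, hence in one
-- block 𝒱_n(a,q) of q consecutive indices, so |j^h - j| < q; likewise u_j and
-- u_{j^h} lie in one residue class 𝒰_n(b,q), so q divides j^h - j. Hence j^h = j.
-- Neither the subgroup H nor q ≤ n plays any role.
module Submission where

open import Defs
open import Data.Nat using (ℕ; zero; suc; _+_; _*_; _∸_; _⊓_; _≤_; _<_; z≤n; ∣_-_∣)
open import Data.Nat.Properties
open import Data.Nat.Divisibility using (>⇒∤) renaming (_∣_ to _∣ℕ_)
open import Data.Fin using (Fin)
open import Data.Fin.Permutation using (Permutation′; _⟨$⟩ʳ_)
open import Data.Fin.Properties using (toℕ-injective)
open import Data.Integer using (+_; _⊖_) renaming (∣_∣ to ∣_∣ℤ; _-_ to _-ℤ_)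
open import Data.Integer.Properties
  using ([+m]-[+n]≡m⊖n; ∣⊖∣-≤; ∣m⊖n∣≡∣n⊖m∣; ∣i-j∣≡∣j-i∣; +-minus-telescope)
import Data.Integer.Divisibility.Signed as Signed
open import Function using (_∘′_)
open import Data.Product using (_,_)
open import Data.Sum using (inj₁; inj₂)
open import Relation.Binary.PropositionalEquality
open import Relation.Nullary using (contradiction)

∣m-n∣<o : ∀ {m n o} → m < n + o → n < m + o → ∣ m - n ∣ < o
∣m-n∣<o {m} {n} {o} m<n+o n<m+o with ≤-total m n
... | inj₁ m≤n = begin-strict
  ∣ m - n ∣ ≡⟨ m≤n⇒∣m-n∣≡n∸m m≤n ⟩
  n ∸ m     <⟨ ∸-monoˡ-< n<m+o m≤n ⟩
  m + o ∸ m ≡⟨ m+n∸m≡n m o ⟩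
  o         ∎
  where open ≤-Reasoning
... | inj₂ n≤m = begin-strict
  ∣ m - n ∣ ≡⟨ m≤n⇒∣n-m∣≡n∸m n≤m ⟩
  m ∸ n     <⟨ ∸-monoˡ-< m<n+o n≤m ⟩
  n + o ∸ n ≡⟨ m+n∸m≡n n o ⟩
  o         ∎
  where open ≤-Reasoning

m∣n∧n<m⇒n≡0 : ∀ {m n} → m ∣ℕ n → n < m → n ≡ 0
m∣n∧n<m⇒n≡0 {n = zero}  _   _   = refl
m∣n∧n<m⇒n≡0 {n = suc _} m∣n n<m = contradiction m∣n (>⇒∤ n<m)

∣[+m]-[+n]∣≡∣m-n∣ : ∀ m n → ∣ + m -ℤ + n ∣ℤ ≡ ∣ m - n ∣
∣[+m]-[+n]∣≡∣m-n∣ m n with ≤-total m n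
... | inj₁ m≤n = begin
  ∣ + m -ℤ + n ∣ℤ ≡⟨ cong ∣_∣ℤ ([+m]-[+n]≡m⊖n m n) ⟩
  ∣ m ⊖ n ∣ℤ      ≡⟨ ∣⊖∣-≤ m≤n ⟩
  n ∸ m           ≡⟨ m≤n⇒∣m-n∣≡n∸m m≤n ⟨
  ∣ m - n ∣       ∎
  where open ≡-Reasoning
... | inj₂ n≤m = begin
  ∣ + m -ℤ + n ∣ℤ ≡⟨ cong ∣_∣ℤ ([+m]-[+n]≡m⊖n m n) ⟩
  ∣ m ⊖ n ∣ℤ      ≡⟨ ∣m⊖n∣≡∣n⊖m∣ m n ⟩
  ∣ n ⊖ m ∣ℤ      ≡⟨ ∣⊖∣-≤ n≤m ⟩
  m ∸ n           ≡⟨ m≤n⇒∣n-m∣≡n∸m n≤m ⟨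
  ∣ m - n ∣       ∎
  where open ≡-Reasoning

≡[mod]-sym : ∀ {i j q} → i ≡ j [mod q ] → j ≡ i [mod q ]
≡[mod]-sym {i} {j} {q} = subst (q ∣ℕ_) (∣i-j∣≡∣j-i∣ (+ i) (+ j))

≡[mod]-trans : ∀ {i j k q} → i ≡ j [mod q ] → j ≡ k [mod q ] → i ≡ k [mod q ]
≡[mod]-trans {i} {j} {k} {q} i≡j j≡k = Signed.∣⇒∣ᵤ
  (subst (+ q Signed.∣_) (+-minus-telescope (+ i) (+ j) (+ k))
    (Signed.∣m∣n⇒∣m+n {m = + i -ℤ + j} {n = + j -ℤ + k} (Signed.∣ᵤ⇒∣ i≡j) (Signed.∣ᵤ⇒∣ j≡k)))

≡[mod]⇒∣∣m-n∣ : ∀ {m n q} → m ≡ n [mod q ] → q ∣ℕ ∣ m - n ∣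
≡[mod]⇒∣∣m-n∣ {m} {n} {q} = subst (q ∣ℕ_) (∣[+m]-[+n]∣≡∣m-n∣ m n)

InV⇒upper : ∀ {n a q j} → InV n a q j → j ≤ (a ∸ 1) * q + q
InV⇒upper {n} {zero}  {q} (_ , j≤0) = ≤-trans j≤0 z≤n
InV⇒upper {n} {suc a} {q} {j} (_ , j≤) = begin
  j               ≤⟨ j≤ ⟩
  (q + a * q) ⊓ n ≤⟨ m⊓n≤m (q + a * q) n ⟩
  q + a * q       ≡⟨ +-comm q (a * q) ⟩
  a * q + q       ∎
  where open ≤-Reasoning

InV⇒∣m-n∣<q : ∀ {n a q x y} → InV n a q x → InV n a q y → ∣ x - y ∣ < q
InV⇒∣m-n∣<q {n} {a} {q} vx@(l<x , _) vy@(l<y , _) =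
  ∣m-n∣<o (≤-<-trans (InV⇒upper {n} {a} vx) (+-monoˡ-< q l<y))
          (≤-<-trans (InV⇒upper {n} {a} vy) (+-monoˡ-< q l<x))

InV∩InU-unique : ∀ {n a b q x y} → InV n a q x → InV n a q y →
                 InU n b q x → InU n b q y → x ≡ y
InV∩InU-unique {n} {a} {b} {q} {x} {y} vx vy (x≡b , _) (y≡b , _) =
  ∣m-n∣≡0⇒m≡n (m∣n∧n<m⇒n≡0 (≡[mod]⇒∣∣m-n∣ {x} {y} x≡y) (InV⇒∣m-n∣<q {n} {a} vx vy))
  where
  x≡y : x ≡ y [mod q ]
  x≡y = ≡[mod]-trans {x} {b} {y} x≡b (≡[mod]-sym {y} {b} y≡b)

idx-injective : ∀ {n} {j k : Fin n} → idx j ≡ idx k → j ≡ k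
idx-injective = toℕ-injective ∘′ suc-injective

lemma4p2 : (n q : ℕ) → q ≤ n →
    (H : Permutation′ n → Set) → IsSubgroup n H →
    (m : ℕ) (P : Vertex n → Fin m) → IsPartition P → PartsAdapted q P →
    ∀ (h : Permutation′ n) → H h → StabilisesParts P (diagAct h) →
    ∀ (j : Fin n) → h ⟨$⟩ʳ j ≡ j
lemma4p2 _ _ _ _ _ _ P _ adapted h _ stabilises j
  with adapted (P (inj₁ j)) | adapted (P (inj₂ j))
... | (a , inV) , _ | _ , (b , inU) =
  sym (idx-injective (InV∩InU-unique {a = a} {b}
    (inV j refl) (inV (h ⟨$⟩ʳ j) (stabilises (inj₁ j)))
    (inU j refl) (inU (h ⟨$⟩ʳ j) (stabilises (inj₂ j)))))
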